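{- Let $\tau\in S_k$ satisfy $\tau(k)=k$ and $\tau(k-1)\neq k-1$, and write $\tau'=\tau(1)\dots\tau(k-1)\in S_{k-1}$. Then the map $\chi$ restricts to a bijection between $S_n(\tau)$ and $\mathcal{R}_n(\tau')^{\times}$.
   Context: Ferrers boards: $\mathcal{F}_n$ is the set of Ferrers boards (left-justified arrays of unit squares bounded by the coordinate axes and a lattice path with east and south steps) whose border is a path from $(0,n)$ to $(n,0)$ never going strictly below $y=n-x$. A full rook placement on $F\in\mathcal{F}_n$ is a set $R$ of unit squares of $F$ with exactly one square in each row and column. For a lattice point $V=(a,b)$, $\Gamma(V)$ is the set of unit squares in $[0,a]\times[0,b]$. A set of squares with at most one per row and column determines a permutation by standardizing (columns left to right, recording row ranks). $(R,F)$ avoids a pattern $\sigma$ if for every vertex $V$ of the border of $F$ the permutation determined by $R\cap\Gamma(V)$ avoids $\sigma$; $\mathcal{R}_n(\sigma)$ is the set of $\sigma$-avoiding pairs $(R,F)$ with $F\in\mathcal{F}_n$. $(R,F)$ is board minimal if $F$ is the smallest Ferrers board containing $R$; $\mathcal{R}_n(\sigma)^\times$ is the set of board-minimal elements of $\mathcal{R}_n(\sigma)$. For $\pi\in S_n$, $\chi(\pi)=(R_\pi,F_\pi)$ where $R_\pi$ consists of the squares in column $i$ and row $\pi(i)$ (columns numbered left to right, rows bottom to top), $1\le i\le n$, and $F_\pi$ is the smallest Ferrers board containing $R_\pi$. $S_n(\tau)$ is the set of permutations of $[n]$ avoiding $\tau$ in the usual sense. -}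

module Defs where

open import Data.Nat as ℕ using (ℕ; zero; suc; _+_; _⊔_)
open import Data.Fin as Fin using (Fin; toℕ)
open import Data.Vec using (Vec; []; _∷_; lookup; tabulate; foldr)
open import Data.Bool using (Bool; true)
open import Data.Product using (Σ; _×_; _,_; ∃)
open import Relation.Binary.PropositionalEquality using (_≡_)
open import Relation.Nullary using (¬_; does)

-- Conventions (0-indexed): column c : Fin n is the unit square strip
-- [c, c+1] × ℝ, row r : Fin n is ℝ × [r, r+1].  The square (c , r) is
-- [c,c+1] × [r,r+1].  Paper's column i / row j (1-based) = c = i-1, r = j-1.

IsPerm : ∀ {n} → Vec (Fin n) n → Set
IsPerm {n} π =
  (∀ i j → lookup π i ≡ lookup π j → i ≡ j) ×
  (∀ (y : Fin n) → ∃ λ x → lookup π x ≡ y)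

PatContains : ∀ {k n} → Vec (Fin k) k → Vec (Fin n) n → Set
PatContains {k} {n} τ π =
  Σ (Fin k → Fin n) λ ι →
    (∀ a b → a Fin.< b → ι a Fin.< ι b) ×
    (∀ a b → lookup τ a Fin.< lookup τ b →
       lookup π (ι a) Fin.< lookup π (ι b))

InSnAvoid : ∀ {k} n → Vec (Fin k) k → Vec (Fin n) n → Set
InSnAvoid n τ π = IsPerm π × ¬ PatContains τ π

-- A set S of squares (with at most one per row and column) contains σ
-- iff its standardization contains σ, i.e. iff there are squares
-- (col a , row a) ∈ S, a : Fin m, with strictly increasing columns and
-- rows ordered like σ.

record Occ {m n : ℕ} (σ : Vec (Fin m) m) (S : Fin n → Fin n → Set) : Set where
  field
    col    : Fin m → Fin n
    row    : Fin m → Fin n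
    inS    : ∀ a → S (col a) (row a)
    colInc : ∀ a b → a Fin.< b → col a Fin.< col b
    rowIso : ∀ a b → lookup σ a Fin.< lookup σ b → row a Fin.< row b

-- Ferrers boards, given by column heights: the board F : Vec ℕ n has
-- n columns, column c consisting of the squares (c , r) with r < height.

Board : ℕ → Set
Board n = Vec ℕ n

-- height of column c (0 beyond the last column)
ht : ∀ {n} → Board n → ℕ → ℕ
ht []       _       = 0
ht (h ∷ hs) zero    = h
ht (h ∷ hs) (suc c) = ht hs c

-- height immediately to the left of the vertical line x = a
-- (the path starts at (0,n))
htL : ∀ {n} → Board n → ℕ → ℕ
htL {n} F zero    = n
htL     F (suc a) = ht F a

-- (a , b) is a lattice point (vertex) of the border path of F,
-- the path running from (0,n) to (n,0) by east and south steps.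
OnBorder : ∀ {n} → Board n → ℕ → ℕ → Set
OnBorder {n} F a b = a ℕ.≤ n × ht F a ℕ.≤ b × b ℕ.≤ htL F a

InFn : ∀ n → Board n → Set
InFn n F =
  (∀ c → ht F (suc c) ℕ.≤ ht F c) ×
  (∀ c → ht F c ℕ.≤ n) ×
  (∀ a b → OnBorder F a b → n ℕ.≤ a + b)

InBoard : ∀ {n} → Board n → Fin n → Fin n → Set
InBoard F c r = toℕ r ℕ.< ht F (toℕ c)

_⊆B_ : ∀ {n} → Board n → Board n → Set
F ⊆B G = ∀ c → ht F c ℕ.≤ ht G c

Rooks : ℕ → Set
Rooks n = Vec (Vec Bool n) n

InR : ∀ {n} → Rooks n → Fin n → Fin n → Set
InR R c r = lookup (lookup R c) r ≡ true

ExactlyOne : ∀ {n} → (Fin n → Set) → Set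
ExactlyOne {n} P = ∃ λ x → P x × (∀ y → P y → y ≡ x)

FullRook : ∀ {n} → Rooks n → Board n → Set
FullRook {n} R F =
  (∀ c r → InR R c r → InBoard F c r) ×
  (∀ (r : Fin n) → ExactlyOne (λ c → InR R c r)) ×
  (∀ (c : Fin n) → ExactlyOne (λ r → InR R c r))

-- R ∩ Γ(a , b) : squares of R inside [0,a] × [0,b]
RΓ : ∀ {n} → Rooks n → ℕ → ℕ → Fin n → Fin n → Set
RΓ R a b c r = InR R c r × suc (toℕ c) ℕ.≤ a × suc (toℕ r) ℕ.≤ b

AvoidsRF : ∀ {m n} → Vec (Fin m) m → Rooks n → Board n → Set
AvoidsRF σ R F = ∀ a b → OnBorder F a b → ¬ Occ σ (RΓ R a b)

InRn : ∀ {m} n → Vec (Fin m) m → Rooks n → Board n → Set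
InRn n σ R F = InFn n F × FullRook R F × AvoidsRF σ R F

BoardMinimal : ∀ n → Rooks n → Board n → Set
BoardMinimal n R F =
  ∀ (G : Board n) → InFn n G → (∀ c r → InR R c r → InBoard G c r) → F ⊆B G

InRnMin : ∀ {m} n → Vec (Fin m) m → Rooks n → Board n → Set
InRnMin n σ R F = InRn n σ R F × BoardMinimal n R F

Rπ : ∀ {n} → Vec (Fin n) n → Rooks n
Rπ π = tabulate λ c → tabulate λ r → does (lookup π c Fin.≟ r)

topOf : ∀ {n m} → Vec (Fin n) m → ℕ
topOf = foldr _ (λ x acc → suc (toℕ x) ⊔ acc) 0

-- suffix maxima: the smallest Ferrers board containing R_π has
-- column c of height 1 + max_{c' ≥ c} π(c')
sufTop : ∀ {n m} → Vec (Fin n) m → Vec ℕ m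
sufTop []       = []
sufTop (x ∷ xs) = topOf (x ∷ xs) ∷ sufTop xs

Fπ : ∀ {n} → Vec (Fin n) n → Board n
Fπ = sufTop

χ : ∀ {n} → Vec (Fin n) n → Rooks n × Board n
χ π = Rπ π , Fπ π

-- Column c of F_π has height 1 + max {π c′ | c′ ≥ c}; this board is the smallest Ferrers board
-- containing R_π, it lies in 𝓕_n by pigeonhole, and every full rook placement is some R_π, so χ is
-- a bijection from permutations onto board-minimal pairs.  For avoidance: an occurrence of τ in π
-- whose last entry sits in column c′ leaves an occurrence of τ′ in Γ(c′, height of column c′), a
-- border vertex.  Conversely an occurrence of τ′ in Γ(a, b), (a, b) on the border, lies weakly left
-- of and below the point (c′, π c′) realising the height b of column a - 1; as τ′ does not end with
-- its maximum, the occurrence avoids that point, which therefore completes it to an occurrence of τ.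
module Submission where

open import Defs
open import Data.Nat as ℕ using (ℕ; zero; suc; _+_; _∸_; z≤n; s≤s; s≤s⁻¹)
open import Data.Nat.Properties
open import Data.Fin as Fin using (Fin; toℕ; fromℕ; fromℕ<; inject₁)
open import Data.Fin.Properties as Finₚ
  using (toℕ-injective; toℕ<n; toℕ-fromℕ; toℕ-fromℕ<; fromℕ<-injective; toℕ-inject₁;
         inject₁-injective; fromℕ≢inject₁; ≤fromℕ; injective⇒≤)
open import Data.Fin.Relation.Unary.Top using (View; view; ‵fromℕ; ‵inject₁)
open import Data.Vec using (Vec; []; _∷_; lookup; tabulate)
open import Data.Vec.Properties using (lookup∘tabulate)
open import Data.Vec.Relation.Binary.Pointwise.Extensional using (ext; Pointwise-≡⇒≡)
open import Data.Bool using (true)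
open import Data.Bool.Properties using (⇔→≡)
open import Data.Product using (_×_; _,_; ∃; ∃₂; proj₁; proj₂)
open import Data.Sum using (inj₁; inj₂)
open import Function using (_∘_; _⇔_; mk⇔; Equivalence)
open import Relation.Binary.PropositionalEquality
open import Relation.Nullary using (¬_; Dec; does; yes; no; contradiction)

open Equivalence using (to; from)

IsInjective : ∀ {n} → Vec (Fin n) n → Set
IsInjective {n} π = ∀ i j → lookup π i ≡ lookup π j → i ≡ j

vec-ext : ∀ {A : Set} {n} {xs ys : Vec A n} → (∀ i → lookup xs i ≡ lookup ys i) → xs ≡ ys
vec-ext p = Pointwise-≡⇒≡ (ext p)

ht-injective : ∀ {n} (F G : Board n) → (∀ c → ht F c ≡ ht G c) → F ≡ G
ht-injective []      []      _ = refl
ht-injective (x ∷ F) (y ∷ G) h = cong₂ _∷_ (h 0) (ht-injective F G (h ∘ suc))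

ht-antitone : ∀ {n} (F : Board n) → (∀ c → ht F (suc c) ℕ.≤ ht F c) →
              ∀ {c} c′ → c ℕ.≤ c′ → ht F c′ ℕ.≤ ht F c
ht-antitone F step zero     z≤n = ≤-refl
ht-antitone F step (suc c′) c≤1+c′ with m≤n⇒m<n∨m≡n c≤1+c′
... | inj₁ c<1+c′ = ≤-trans (step c′) (ht-antitone F step c′ (s≤s⁻¹ c<1+c′))
... | inj₂ refl   = ≤-refl

ht≤htL : ∀ {n} (F : Board n) → (∀ c → ht F (suc c) ℕ.≤ ht F c) → (∀ c → ht F c ℕ.≤ n) →
         ∀ a → ht F a ℕ.≤ htL F a
ht≤htL F step bound zero    = bound 0
ht≤htL F step bound (suc a) = step a

lookup<topOf : ∀ {n m} (π : Vec (Fin n) m) i → toℕ (lookup π i) ℕ.< topOf π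
lookup<topOf (x ∷ xs) Fin.zero    = m≤m⊔n (suc (toℕ x)) (topOf xs)
lookup<topOf (x ∷ xs) (Fin.suc i) = ≤-trans (lookup<topOf xs i) (m≤n⊔m (suc (toℕ x)) (topOf xs))

topOf-least : ∀ {n m} (π : Vec (Fin n) m) {h} → (∀ i → toℕ (lookup π i) ℕ.< h) → topOf π ℕ.≤ h
topOf-least []       _     = z≤n
topOf-least (x ∷ xs) below = ⊔-lub (below Fin.zero) (topOf-least xs (below ∘ Fin.suc))

topOf-attained : ∀ {n m} (x : Fin n) (xs : Vec (Fin n) m) →
                 ∃ λ i → topOf (x ∷ xs) ≡ suc (toℕ (lookup (x ∷ xs) i))
topOf-attained x []       = Fin.zero , ⊔-identityʳ (suc (toℕ x))
topOf-attained x (y ∷ ys) with ⊔-sel (suc (toℕ x)) (topOf (y ∷ ys))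
... | inj₁ e = Fin.zero , e
... | inj₂ e with topOf-attained y ys
...   | i , e′ = Fin.suc i , trans e e′

lookup<ht-sufTop : ∀ {n m} (π : Vec (Fin n) m) {c} c′ → c ℕ.≤ toℕ c′ →
                   toℕ (lookup π c′) ℕ.< ht (sufTop π) c
lookup<ht-sufTop (x ∷ xs) {zero}  c′           _       = lookup<topOf (x ∷ xs) c′
lookup<ht-sufTop (x ∷ xs) {suc c} (Fin.suc c′) (s≤s c≤c′) = lookup<ht-sufTop xs c′ c≤c′

ht-sufTop-least : ∀ {n m} (π : Vec (Fin n) m) {c h} →
                  (∀ c′ → c ℕ.≤ toℕ c′ → toℕ (lookup π c′) ℕ.< h) → ht (sufTop π) c ℕ.≤ h
ht-sufTop-least []       {c}     _     = z≤n
ht-sufTop-least (x ∷ xs) {zero}  below = topOf-least (x ∷ xs) (λ i → below i z≤n)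
ht-sufTop-least (x ∷ xs) {suc c} below =
  ht-sufTop-least xs (λ c′ c≤c′ → below (Fin.suc c′) (s≤s c≤c′))

ht-sufTop-attained : ∀ {n m} (π : Vec (Fin n) m) c → c ℕ.< m →
                     ∃ λ c′ → c ℕ.≤ toℕ c′ × ht (sufTop π) c ≡ suc (toℕ (lookup π c′))
ht-sufTop-attained (x ∷ xs) zero    _ with topOf-attained x xs
... | c′ , e = c′ , z≤n , e
ht-sufTop-attained (x ∷ xs) (suc c) (s≤s c<m) with ht-sufTop-attained xs c c<m
... | c′ , c≤c′ , e = Fin.suc c′ , s≤s c≤c′ , e

ht-sufTop-step : ∀ {n m} (π : Vec (Fin n) m) c → ht (sufTop π) (suc c) ℕ.≤ ht (sufTop π) c
ht-sufTop-step π c = ht-sufTop-least π (λ c′ c<c′ → lookup<ht-sufTop π c′ (<⇒≤ c<c′))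

ht-sufTop-bound : ∀ {n m} (π : Vec (Fin n) m) c → ht (sufTop π) c ℕ.≤ n
ht-sufTop-bound π c = ht-sufTop-least π (λ c′ _ → toℕ<n (lookup π c′))

-- Pigeonhole: the n ∸ a columns from a on carry distinct values, all below the height of column a.
n≤a+ht-sufTop : ∀ {n} (π : Vec (Fin n) n) → IsInjective π → ∀ {a} → a ℕ.< n →
                n ℕ.≤ a + ht (sufTop π) a
n≤a+ht-sufTop {n} π π-inj {a} a<n =
  subst (ℕ._≤ a + h) (m+[n∸m]≡n a≤n) (+-monoʳ-≤ a (injective⇒≤ value-injective))
  where
  h : ℕ
  h = ht (sufTop π) a
  a≤n : a ℕ.≤ n
  a≤n = <⇒≤ a<n
  column : Fin (n ∸ a) → Fin n
  column i = fromℕ< (subst (a + toℕ i ℕ.<_) (m+[n∸m]≡n a≤n) (+-monoʳ-< a (toℕ<n i)))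
  value : Fin (n ∸ a) → Fin h
  value i = fromℕ< (lookup<ht-sufTop π (column i)
                      (subst (a ℕ.≤_) (sym (toℕ-fromℕ< _)) (m≤m+n a (toℕ i))))
  value-injective : ∀ {i i′} → value i ≡ value i′ → i ≡ i′
  value-injective {i} {i′} e = toℕ-injective (+-cancelˡ-≡ a _ _ (fromℕ<-injective _ _ _ _ same-column))
    where
    same-column : column i ≡ column i′
    same-column = π-inj _ _ (toℕ-injective (fromℕ<-injective _ _ _ _ e))

sufTop∈Fn : ∀ {n} (π : Vec (Fin n) n) → IsInjective π → InFn n (sufTop π)
sufTop∈Fn {n} π π-inj = ht-sufTop-step π , ht-sufTop-bound π , above-diagonal
  where
  above-diagonal : ∀ a b → OnBorder (sufTop π) a b → n ℕ.≤ a + b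
  above-diagonal a b (_ , ht≤b , _) with a ℕ.<? n
  ... | yes a<n = ≤-trans (n≤a+ht-sufTop π π-inj a<n) (+-monoʳ-≤ a ht≤b)
  ... | no  a≮n = ≤-trans (≮⇒≥ a≮n) (m≤m+n a b)

does≡true⇔ : ∀ {A : Set} (a? : Dec A) → does a? ≡ true ⇔ A
does≡true⇔ (yes a) = mk⇔ (λ _ → a) (λ _ → refl)
does≡true⇔ (no ¬a) = mk⇔ (λ ()) (λ a → contradiction a ¬a)

InR-Rπ : ∀ {n} (π : Vec (Fin n) n) c r → InR (Rπ π) c r ⇔ lookup π c ≡ r
InR-Rπ π c r =
  subst (λ b → b ≡ true ⇔ lookup π c ≡ r) (sym lookup-Rπ) (does≡true⇔ (lookup π c Fin.≟ r))
  where
  lookup-Rπ : lookup (lookup (Rπ π) c) r ≡ does (lookup π c Fin.≟ r)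
  lookup-Rπ = trans (cong (λ v → lookup v r) (lookup∘tabulate _ c)) (lookup∘tabulate _ r)

InR-Rπ⁺ : ∀ {n} (π : Vec (Fin n) n) {c r} → lookup π c ≡ r → InR (Rπ π) c r
InR-Rπ⁺ π = from (InR-Rπ π _ _)

InR-Rπ⁻ : ∀ {n} (π : Vec (Fin n) n) {c r} → InR (Rπ π) c r → lookup π c ≡ r
InR-Rπ⁻ π = to (InR-Rπ π _ _)

Rooks-ext : ∀ {n} {R R′ : Rooks n} → (∀ c r → InR R c r ⇔ InR R′ c r) → R ≡ R′
Rooks-ext same = vec-ext λ c → vec-ext λ r → ⇔→≡ (same c r)

Rπ-injective : ∀ {n} {π σ : Vec (Fin n) n} → Rπ π ≡ Rπ σ → π ≡ σ
Rπ-injective {π = π} {σ} e =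
  vec-ext λ c → sym (InR-Rπ⁻ σ (subst (λ R → InR R c (lookup π c)) e (InR-Rπ⁺ π refl)))

Rπ⊆sufTop : ∀ {n} (π : Vec (Fin n) n) c r → InR (Rπ π) c r → InBoard (sufTop π) c r
Rπ⊆sufTop π c r rook = subst (λ r → toℕ r ℕ.< _) (InR-Rπ⁻ π rook) (lookup<ht-sufTop π c ≤-refl)

Rπ-FullRook : ∀ {n} (π : Vec (Fin n) n) → IsPerm π → FullRook (Rπ π) (sufTop π)
Rπ-FullRook π (π-inj , π-surj) = Rπ⊆sufTop π , one-per-row , one-per-column
  where
  one-per-row : ∀ r → ExactlyOne (λ c → InR (Rπ π) c r)
  one-per-row r with π-surj r
  ... | c , πc≡r =
    c , InR-Rπ⁺ π πc≡r , λ c′ rook → π-inj c′ c (trans (InR-Rπ⁻ π rook) (sym πc≡r))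
  one-per-column : ∀ c → ExactlyOne (λ r → InR (Rπ π) c r)
  one-per-column c = lookup π c , InR-Rπ⁺ π refl , λ r rook → sym (InR-Rπ⁻ π rook)

sufTop-BoardMinimal : ∀ {n} (π : Vec (Fin n) n) → BoardMinimal n (Rπ π) (sufTop π)
sufTop-BoardMinimal π G (G-step , _ , _) Rπ⊆G c =
  ht-sufTop-least π λ c′ c≤c′ →
    ≤-trans (Rπ⊆G c′ _ (InR-Rπ⁺ π refl)) (ht-antitone G G-step (toℕ c′) c≤c′)

FullRook⇒Rπ : ∀ {n} (R : Rooks n) (F : Board n) → FullRook R F → ∃ λ π → IsPerm π × Rπ π ≡ R
FullRook⇒Rπ {n} R _ (_ , one-per-row , one-per-column) = π , (π-inj , π-surj) , Rπ≡R
  where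
  π : Vec (Fin n) n
  π = tabulate (proj₁ ∘ one-per-column)
  rook : ∀ c → InR R c (lookup π c)
  rook c = subst (InR R c) (sym (lookup∘tabulate _ c)) (proj₁ (proj₂ (one-per-column c)))
  rook-unique : ∀ {c r} → InR R c r → lookup π c ≡ r
  rook-unique {c} {r} h = trans (lookup∘tabulate _ c) (sym (proj₂ (proj₂ (one-per-column c)) r h))
  π-inj : IsInjective π
  π-inj c c′ e = trans (unique c (rook c)) (sym (unique c′ (subst (InR R c′) (sym e) (rook c′))))
    where
    unique : ∀ c′ → InR R c′ (lookup π c) → c′ ≡ proj₁ (one-per-row (lookup π c))
    unique = proj₂ (proj₂ (one-per-row (lookup π c)))
  π-surj : ∀ r → ∃ λ c → lookup π c ≡ r
  π-surj r = proj₁ (one-per-row r) , rook-unique (proj₁ (proj₂ (one-per-row r)))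
  Rπ≡R : Rπ π ≡ R
  Rπ≡R = Rooks-ext λ c r →
    mk⇔ (λ h → subst (InR R c) (InR-Rπ⁻ π h) (rook c)) (λ h → InR-Rπ⁺ π (rook-unique h))

BoardMinimal⇒≡sufTop : ∀ {n} (π : Vec (Fin n) n) {F : Board n} → IsInjective π → InFn n F →
                       (∀ c r → InR (Rπ π) c r → InBoard F c r) → BoardMinimal n (Rπ π) F →
                       F ≡ sufTop π
BoardMinimal⇒≡sufTop π {F} π-inj F∈Fn Rπ⊆F F-min = ht-injective F (sufTop π) λ c →
  ≤-antisym (F-min (sufTop π) (sufTop∈Fn π π-inj) (Rπ⊆sufTop π) c)
            (sufTop-BoardMinimal π F F∈Fn Rπ⊆F c)

inject₁-mono-< : ∀ {m} {x y : Fin m} → x Fin.< y → inject₁ x Fin.< inject₁ y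
inject₁-mono-< {x = x} {y} = subst₂ ℕ._<_ (sym (toℕ-inject₁ x)) (sym (toℕ-inject₁ y))

inject₁-cancel-< : ∀ {m} {x y : Fin m} → inject₁ x Fin.< inject₁ y → x Fin.< y
inject₁-cancel-< {x = x} {y} = subst₂ ℕ._<_ (toℕ-inject₁ x) (toℕ-inject₁ y)

inject₁<fromℕ : ∀ {m} (x : Fin m) → inject₁ x Fin.< fromℕ m
inject₁<fromℕ {m} x = subst₂ ℕ._<_ (sym (toℕ-inject₁ x)) (sym (toℕ-fromℕ m)) (toℕ<n x)

fromℕ≮ : ∀ {m} (y : Fin (suc m)) → ¬ (fromℕ m Fin.< y)
fromℕ≮ y fromℕ<y = <⇒≱ fromℕ<y (≤fromℕ y)

module AppendedMaximum {j : ℕ}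
  (τ : Vec (Fin (suc (suc j))) (suc (suc j))) (τ′ : Vec (Fin (suc j)) (suc j))
  (τ-last : lookup τ (fromℕ (suc j)) ≡ fromℕ (suc j))
  (τ-init : ∀ i → lookup τ (inject₁ i) ≡ inject₁ (lookup τ′ i)) where

  LastNotMaximum : Set
  LastNotMaximum = ∃ λ x → lookup τ′ (fromℕ j) Fin.< lookup τ′ x

  toℕ-τ-init : ∀ i → toℕ (lookup τ (inject₁ i)) ≡ toℕ (lookup τ′ i)
  toℕ-τ-init i = trans (cong toℕ (τ-init i)) (toℕ-inject₁ _)

  τ-init-<⁺ : ∀ {x y} → lookup τ′ x Fin.< lookup τ′ y →
              lookup τ (inject₁ x) Fin.< lookup τ (inject₁ y)
  τ-init-<⁺ {x} {y} = subst₂ ℕ._<_ (sym (toℕ-τ-init x)) (sym (toℕ-τ-init y))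

  τ-init-<⁻ : ∀ {x y} → lookup τ (inject₁ x) Fin.< lookup τ (inject₁ y) →
              lookup τ′ x Fin.< lookup τ′ y
  τ-init-<⁻ {x} {y} = subst₂ ℕ._<_ (toℕ-τ-init x) (toℕ-τ-init y)

  τ-init<τ-last : ∀ x → lookup τ (inject₁ x) Fin.< lookup τ (fromℕ (suc j))
  τ-init<τ-last x rewrite τ-init x | τ-last = inject₁<fromℕ (lookup τ′ x)

  τ-last-maximal : ∀ y → ¬ (lookup τ (fromℕ (suc j)) Fin.< lookup τ y)
  τ-last-maximal y rewrite τ-last = fromℕ≮ (lookup τ y)

  τ′-last-not-max : IsPerm τ → lookup τ (inject₁ (fromℕ j)) ≢ inject₁ (fromℕ j) → LastNotMaximum
  τ′-last-not-max (_ , τ-surj) τ≢ with τ-surj (inject₁ (fromℕ j))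
  ... | x , τx≡ = position-of-max x (view x) τx≡
    where
    τ′-last≢max : lookup τ′ (fromℕ j) ≢ fromℕ j
    τ′-last≢max e = τ≢ (trans (τ-init (fromℕ j)) (cong inject₁ e))
    position-of-max : ∀ x → View x → lookup τ x ≡ inject₁ (fromℕ j) → LastNotMaximum
    position-of-max _ ‵fromℕ        e = contradiction (trans (sym τ-last) e) fromℕ≢inject₁
    position-of-max _ (‵inject₁ x′) e = x′ , subst (lookup τ′ (fromℕ j) Fin.<_) (sym τ′x′≡max)
                                              (Finₚ.≤∧≢⇒< (≤fromℕ _) τ′-last≢max)
      where
      τ′x′≡max : lookup τ′ x′ ≡ fromℕ j
      τ′x′≡max = inject₁-injective (trans (sym (τ-init x′)) e)

  module _ {n : ℕ} (π : Vec (Fin n) n) where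

    PatContains⇒border-Occ : PatContains τ π →
                             ∃₂ λ a b → OnBorder (sufTop π) a b × Occ τ′ (RΓ (Rπ π) a b)
    PatContains⇒border-Occ (ι , ι-mono , ι-iso) =
      toℕ c′ , ht (sufTop π) (toℕ c′) ,
      (<⇒≤ (toℕ<n c′) , ≤-refl , ht≤htL (sufTop π) (ht-sufTop-step π) (ht-sufTop-bound π) (toℕ c′)) ,
      record
        { col    = ι ∘ inject₁
        ; row    = lookup π ∘ ι ∘ inject₁
        ; inS    = λ x → InR-Rπ⁺ π refl , ι-mono _ _ (inject₁<fromℕ x) ,
                         ≤-trans (ι-iso _ _ (τ-init<τ-last x)) (<⇒≤ (lookup<ht-sufTop π c′ ≤-refl))
        ; colInc = λ x y x<y → ι-mono _ _ (inject₁-mono-< x<y)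
        ; rowIso = λ x y τ′x<τ′y → ι-iso _ _ (τ-init-<⁺ τ′x<τ′y)
        }
      where
      c′ : Fin n
      c′ = ι (fromℕ (suc j))

    extend-Occ : (O : Occ τ′ (InR (Rπ π))) (c′ : Fin n) → (∀ x → Occ.col O x Fin.< c′) →
                 (∀ x → Occ.row O x Fin.< lookup π c′) → PatContains τ π
    extend-Occ O c′ col<c′ row<πc′ = ι ∘ view , ι-mono , ι-iso
      where
      open Occ O
      row≡ : ∀ x → lookup π (col x) ≡ row x
      row≡ x = InR-Rπ⁻ π (inS x)
      ι : ∀ {i} → View i → Fin n
      ι ‵fromℕ        = c′
      ι (‵inject₁ x) = col x
      ι-mono : ∀ p q → p Fin.< q → ι (view p) Fin.< ι (view q)
      ι-mono p q p<q with view p | view q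
      ... | ‵fromℕ      | _           = contradiction p<q (fromℕ≮ q)
      ... | ‵inject₁ x | ‵fromℕ      = col<c′ x
      ... | ‵inject₁ x | ‵inject₁ y = colInc x y (inject₁-cancel-< p<q)
      ι-iso : ∀ p q → lookup τ p Fin.< lookup τ q → lookup π (ι (view p)) Fin.< lookup π (ι (view q))
      ι-iso p q τp<τq with view p | view q
      ... | ‵fromℕ      | _           = contradiction τp<τq (τ-last-maximal q)
      ... | ‵inject₁ x | ‵fromℕ      = subst (Fin._< lookup π c′) (sym (row≡ x)) (row<πc′ x)
      ... | ‵inject₁ x | ‵inject₁ y =
        subst₂ Fin._<_ (sym (row≡ x)) (sym (row≡ y)) (rowIso x y (τ-init-<⁻ τp<τq))

    module _ (π-inj : IsInjective π) (last-not-max : LastNotMaximum) where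

      -- The last entry of the occurrence cannot lie in column c′: its row would then be π c′,
      -- yet it lies below the entry x that τ′ places above it.
      weakly-below⇒PatContains : (O : Occ τ′ (InR (Rπ π))) (c′ : Fin n) →
                                 (∀ x → Occ.col O x Fin.≤ c′) → (∀ x → Occ.row O x Fin.≤ lookup π c′) →
                                 PatContains τ π
      weakly-below⇒PatContains O c′ col≤c′ row≤πc′ = extend-Occ O c′ col<c′ row<πc′
        where
        open Occ O
        last : Fin (suc j)
        last = fromℕ j
        row≡ : ∀ x → lookup π (col x) ≡ row x
        row≡ x = InR-Rπ⁻ π (inS x)
        col≤last : ∀ x → col x Fin.≤ col last
        col≤last x with x Fin.≟ last
        ... | yes refl = ≤-refl
        ... | no x≢last = <⇒≤ (colInc x last (Finₚ.≤∧≢⇒< (≤fromℕ x) x≢last))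
        last≢c′ : col last ≢ c′
        last≢c′ e =
          <-irrefl refl (≤-trans (rowIso last x (proj₂ last-not-max)) (≤-trans (row≤πc′ x) πc′≤last))
          where
          x : Fin (suc j)
          x = proj₁ last-not-max
          πc′≤last : toℕ (lookup π c′) ℕ.≤ toℕ (row last)
          πc′≤last = ≤-reflexive (cong toℕ (trans (cong (lookup π) (sym e)) (row≡ last)))
        col<c′ : ∀ x → col x Fin.< c′
        col<c′ x = ≤-<-trans (col≤last x) (Finₚ.≤∧≢⇒< (col≤c′ last) last≢c′)
        row<πc′ : ∀ x → row x Fin.< lookup π c′
        row<πc′ x = Finₚ.≤∧≢⇒< (row≤πc′ x) λ e →
          <-irrefl (cong toℕ (π-inj _ _ (trans (row≡ x) e))) (col<c′ x)

      border-Occ⇒PatContains : ∀ {a b} → OnBorder (sufTop π) a b → Occ τ′ (RΓ (Rπ π) a b) →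
                               PatContains τ π
      border-Occ⇒PatContains {zero} _ O = contradiction (proj₁ (proj₂ (Occ.inS O Fin.zero))) λ ()
      border-Occ⇒PatContains {suc a} {b} (a<n , _ , b≤ht) O with ht-sufTop-attained π a a<n
      ... | c′ , a≤c′ , ht≡ = weakly-below⇒PatContains O′ c′
              (λ x → ≤-trans (s≤s⁻¹ (proj₁ (proj₂ (inS x)))) a≤c′)
              (λ x → s≤s⁻¹ (≤-trans (proj₂ (proj₂ (inS x))) (subst (b ℕ.≤_) ht≡ b≤ht)))
        where
        open Occ O
        O′ : Occ τ′ (InR (Rπ π))
        O′ = record { col = col ; row = row ; inS = proj₁ ∘ inS ; colInc = colInc ; rowIso = rowIso }

lemma4p4 : (j n : ℕ) (τ : Vec (Fin (suc (suc j))) (suc (suc j)))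
           (τ′ : Vec (Fin (suc j)) (suc j)) →
           IsPerm τ →
           lookup τ (fromℕ (suc j)) ≡ fromℕ (suc j) →
           lookup τ (inject₁ (fromℕ j)) ≢ inject₁ (fromℕ j) →
           (∀ i → lookup τ (inject₁ i) ≡ inject₁ (lookup τ′ i)) →
           ((π : Vec (Fin n) n) → InSnAvoid n τ π →
              InRnMin n τ′ (Rπ π) (Fπ π))
           × ((π σ : Vec (Fin n) n) → InSnAvoid n τ π → InSnAvoid n τ σ →
              χ π ≡ χ σ → π ≡ σ)
           × ((R : Rooks n) (F : Board n) → InRnMin n τ′ R F →
              ∃ λ π → InSnAvoid n τ π × χ π ≡ (R , F))
lemma4p4 j n τ τ′ τ-perm τ-last τ-last≢ τ-init = into , injective , onto
  where
  open AppendedMaximum τ τ′ τ-last τ-init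
  last-not-max : LastNotMaximum
  last-not-max = τ′-last-not-max τ-perm τ-last≢

  into : (π : Vec (Fin n) n) → InSnAvoid n τ π → InRnMin n τ′ (Rπ π) (Fπ π)
  into π (π-perm , π-avoids) =
    ( sufTop∈Fn π (proj₁ π-perm) , Rπ-FullRook π π-perm
    , λ a b v O → π-avoids (border-Occ⇒PatContains π (proj₁ π-perm) last-not-max v O))
    , sufTop-BoardMinimal π

  injective : (π σ : Vec (Fin n) n) → InSnAvoid n τ π → InSnAvoid n τ σ → χ π ≡ χ σ → π ≡ σ
  injective _ _ _ _ χ≡ = Rπ-injective (cong proj₁ χ≡)

  onto : (R : Rooks n) (F : Board n) → InRnMin n τ′ R F → ∃ λ π → InSnAvoid n τ π × χ π ≡ (R , F)
  onto R F ((F∈Fn , R-full , R-avoids) , F-min) with FullRook⇒Rπ R F R-full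
  ... | π , π-perm , refl = π , (π-perm , π-avoids) , cong (Rπ π ,_) (sym F≡sufTop)
    where
    F≡sufTop : F ≡ sufTop π
    F≡sufTop = BoardMinimal⇒≡sufTop π (proj₁ π-perm) F∈Fn (proj₁ R-full) F-min
    π-avoids : ¬ PatContains τ π
    π-avoids occ with PatContains⇒border-Occ π occ
    ... | a , b , v , O = R-avoids a b (subst (λ G → OnBorder G a b) (sym F≡sufTop) v) O
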